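{- For every connected $3$-regular graph $G$, the following are equivalent: (1) $G$ has a cut-vertex; (2) $\tau(G)\le 1/2$; (3) $\tau(G)<2/3$.
   Context: All graphs are finite, simple and undirected; $\omega(H)$ denotes the number of connected components of $H$. For a real $t$, a graph $G$ is $t$-tough if $|S|\ge t\,\omega(G-S)$ for every $S\subseteq V(G)$ with $\omega(G-S)>1$. The toughness $\tau(G)$ is the largest $t$ for which $G$ is $t$-tough, with the convention $\tau(K_n)=\infty$ for all $n\ge1$. -}

module Defs where

open import Data.Nat as ℕ using (ℕ; suc)
open import Data.Bool using (Bool; true; false)
open import Data.Fin using (Fin)
open import Data.Fin.Subset using (Subset; _∉_; ∣_∣; ⁅_⁆) renaming (⊥ to ∅)
open import Data.Vec using (tabulate)
open import Data.Product using (Σ; ∃; ∃-syntax; _×_)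
open import Data.Integer using (+_)
open import Data.Rational using (ℚ; _≤_; _<_; _*_; _/_)
open import Function.Bundles using (_⇔_)
open import Relation.Binary.PropositionalEquality using (_≡_)

record Graph (n : ℕ) : Set where
  field
    adj    : Fin n → Fin n → Bool
    sym    : ∀ u v → adj u v ≡ adj v u
    irrefl : ∀ v → adj v v ≡ false
open Graph public

module _ {n : ℕ} (G : Graph n) where

  Adj : Fin n → Fin n → Set
  Adj u v = adj G u v ≡ true

  degree : Fin n → ℕ
  degree v = ∣ tabulate (adj G v) ∣

  Regular : ℕ → Set
  Regular r = ∀ v → degree v ≡ r

  -- Path S u v : a walk from u to v in G - S (all vertices outside S)
  data Path (S : Subset n) : Fin n → Fin n → Set where
    here : ∀ {u} → u ∉ S → Path S u u
    step : ∀ {u w v} → u ∉ S → Adj u w → Path S w v → Path S u v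

  Connected : Set
  Connected = (0 ℕ.< n) × (∀ u v → Path ∅ u v)

  -- ω(G - S) ≡ k : there is a surjective labelling of the vertices of G - S
  -- by Fin k whose fibres are exactly the connected components.
  HasComponents : Subset n → ℕ → Set
  HasComponents S k =
    Σ ((v : Fin n) → v ∉ S → Fin k) λ c →
      (∀ i → ∃[ v ] Σ (v ∉ S) λ p → c v p ≡ i) ×
      (∀ u (p : u ∉ S) v (q : v ∉ S) → (c u p ≡ c v q) ⇔ Path S u v)

  CutVertex : Fin n → Set
  CutVertex v = ∃[ k ] ∃[ k′ ] HasComponents ∅ k × HasComponents ⁅ v ⁆ k′ × k ℕ.< k′

  HasCutVertex : Set
  HasCutVertex = ∃[ v ] CutVertex v

  ℕtoℚ : ℕ → ℚ
  ℕtoℚ m = (+ m) / 1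

  Tough : ℚ → Set
  Tough t = ∀ (S : Subset n) k → HasComponents S k → 1 ℕ.< k →
            t * ℕtoℚ k ≤ ℕtoℚ ∣ S ∣

  -- τ(G) ≤ q : every t for which G is t-tough satisfies t ≤ q
  -- (τ(G) is the largest such t; τ(K_n) = ∞ makes this false for complete graphs)
  τ≤ : ℚ → Set
  τ≤ q = ∀ t → Tough t → t ≤ q

  τ< : ℚ → Set
  τ< q = ∃[ r ] r < q × τ≤ r

{-# OPTIONS --safe #-}
module Submission where

-- A cut vertex x leaves at least two components, so t * 2 ≤ t * ω(G - x) ≤ 1 whenever G is
-- t-tough, i.e. τ(G) ≤ 1/2 < 2/3.  Conversely, suppose G has no cut vertex and S leaves k ≥ 2
-- components.  Each component C sends at least two edges into S: connectivity gives an edge xs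
-- from C to S, and if s is the only neighbour of x in S, then x has a neighbour z in C; a path
-- from z to s avoiding x leaves C through a second edge, at a vertex other than x.  Every vertex
-- of S has degree 3, so double counting the edges between S and G - S gives 2k ≤ 3|S|: G is
-- 2/3-tough.  All case distinctions are constructive because reachability in G - S is decidable.

open import Defs hiding (sym)
open import Level using (0ℓ)
open import Function using (_∘_)
open import Function.Bundles using (_⇔_; mk⇔; module Equivalence)
open import Relation.Binary using (Rel; Decidable; Symmetric; Transitive)
open import Relation.Binary.PropositionalEquality
open import Relation.Nullary using (¬_; Dec; yes; no; does; ¬?; _×-dec_; contradiction)
open import Relation.Nullary.Decidable using (decidable-stable; dec-true; toWitness)
import Relation.Nullary.Decidable as Dec
open import Data.Product using (Σ; ∃; ∃₂; ∃-syntax; _×_; _,_; proj₁; proj₂)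
open import Data.Sum using (_⊎_; inj₁; inj₂)
open import Data.Bool using (Bool; true; false; if_then_else_)
open import Data.Bool.Properties using () renaming (_≟_ to _≟ᵇ_)
open import Data.Nat using (ℕ; zero; suc; _+_; _*_; _≤_; _<_; z≤n; s≤s; _≤?_; >-nonZero⁻¹)
open import Data.Nat.Properties hiding (_≟_; suc-injective)
open import Data.Nat.Coprimality using (1-coprimeTo) renaming (sym to Coprime-sym)
open import Data.Fin using (Fin; zero; suc; _≟_; fromℕ<; punchIn)
open import Data.Fin.Properties using (any?; punchInᵢ≢i; suc-injective; nonZeroIndex)
open import Data.Fin.Subset using (Subset; _∈_; _∉_; _⊆_; _∪_; ∣_∣; ⁅_⁆) renaming (⊥ to ∅)
open import Data.Fin.Subset.Properties
  using ( _∈?_; x∈p∪q⁻; x∈p∪q⁺; x∈⁅x⁆; x∈⁅y⁆⇒x≡y; x≢y⇒x∉⁅y⁆; x∉⁅y⁆⇒x≢y; ∉⊥; ∣⁅x⁆∣≡1; ∣p∣≤n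
        ; p⊂q⇒∣p∣<∣q∣)
open import Data.Vec using (tabulate; lookup)
open import Data.Vec.Properties using (tabulate∘lookup; []=⇒lookup)
open import Data.List using ([]; _∷_; allFin)
open import Data.List.Relation.Unary.Any as Any using (Any; here; there)
open import Data.List.Membership.Propositional.Properties using (∈-allFin)
open import Algebra.Properties.Semiring.Sum +-*-semiring
  using (sum; sum-syntax; sum-cong-≗; ∑-comm; sum-replicate-zero; *-distribˡ-sum; *-distribʳ-sum)
open import Data.Integer as ℤ using (+_; -[1+_])
import Data.Integer.Properties as ℤ
open import Data.Rational as ℚ using (ℚ; mkℚ; _/_; toℚᵘ)
import Data.Rational.Properties as ℚ
open import Data.Rational.Properties using (normalize-coprime; toℚᵘ-cancel-≤; toℚᵘ-mono-≤; toℚᵘ-homo-*)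
import Data.Rational.Unnormalised as ℚᵘ
import Data.Rational.Unnormalised.Properties as ℚᵘ

open Equivalence using (to; from)

𝟙 : Bool → ℕ
𝟙 true  = 1
𝟙 false = 0

sum-mono-≤ : ∀ {m} {f g : Fin m → ℕ} → (∀ i → f i ≤ g i) → sum f ≤ sum g
sum-mono-≤ {zero}  _   = z≤n
sum-mono-≤ {suc m} f≤g = +-mono-≤ (f≤g zero) (sum-mono-≤ (f≤g ∘ suc))

sum-const : ∀ m c → ∑[ i < m ] c ≡ m * c
sum-const zero    c = refl
sum-const (suc m) c = cong (_+_ c) (sum-const m c)

term≤sum : ∀ {m} (f : Fin m → ℕ) i → f i ≤ sum f
term≤sum f zero    = m≤m+n (f zero) _
term≤sum f (suc i) = ≤-trans (term≤sum (f ∘ suc) i) (m≤n+m _ (f zero))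

two-terms≤sum : ∀ {m} (f : Fin m → ℕ) {i j} → i ≢ j → f i + f j ≤ sum f
two-terms≤sum f {zero}  {zero}  i≢j = contradiction refl i≢j
two-terms≤sum f {zero}  {suc j} _   = +-monoʳ-≤ (f zero) (term≤sum (f ∘ suc) j)
two-terms≤sum f {suc i} {zero}  i≢j = subst (_≤ sum f) (+-comm (f zero) _) (two-terms≤sum f (i≢j ∘ sym))
two-terms≤sum f {suc i} {suc j} i≢j = ≤-trans (two-terms≤sum (f ∘ suc) (i≢j ∘ cong suc)) (m≤n+m _ (f zero))

sum-indicator : ∀ {k} (j : Fin k) x → ∑[ i < k ] (if does (j ≟ i) then x else 0) ≡ x
sum-indicator {suc k} zero    x = trans (cong (_+_ x) (sum-replicate-zero k)) (+-identityʳ x)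
sum-indicator         (suc j) x = sum-indicator j x

sum-fibres : ∀ {m k} (ℓ : Fin m → Fin k) (w : Fin m → ℕ) →
             ∑[ i < k ] ∑[ v < m ] (if does (ℓ v ≟ i) then w v else 0) ≡ sum w
sum-fibres ℓ w = trans (∑-comm λ i v → if does (ℓ v ≟ i) then w v else 0)
                       (sum-cong-≗ λ v → sum-indicator (ℓ v) (w v))

∣tabulate∣≡sum : ∀ {m} (f : Fin m → Bool) → ∣ tabulate f ∣ ≡ sum (𝟙 ∘ f)
∣tabulate∣≡sum {zero}  f = refl
∣tabulate∣≡sum {suc m} f with f zero
... | true  = cong suc (∣tabulate∣≡sum (f ∘ suc))
... | false = ∣tabulate∣≡sum (f ∘ suc)

∣p∣≡sum : ∀ {m} (p : Subset m) → ∣ p ∣ ≡ sum (𝟙 ∘ lookup p)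
∣p∣≡sum p = trans (cong ∣_∣ (sym (tabulate∘lookup p))) (∣tabulate∣≡sum (lookup p))

distinct⇒1< : ∀ {k} {i j : Fin k} → i ≢ j → 1 < k
distinct⇒1< {suc zero}    {zero} {zero} i≢j = contradiction refl i≢j
distinct⇒1< {suc (suc _)} _                  = s≤s (s≤s z≤n)

other-index : ∀ {k} → 1 < k → (i : Fin k) → ∃[ j ] j ≢ i
other-index (s≤s (s≤s _)) i = punchIn i zero , punchInᵢ≢i i zero

-- HasComponents G S k is Labelling (Path G S) (_∉ S) k.
Labelling : {A : Set} → Rel A 0ℓ → (A → Set) → ℕ → Set
Labelling {A} R D k =
  Σ ((a : A) → D a → Fin k) λ c →
    (∀ i → ∃[ a ] Σ (D a) λ d → c a d ≡ i) ×
    (∀ a d b e → (c a d ≡ c b e) ⇔ R a b)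

module _ {A : Set} {R : Rel A 0ℓ} (R? : Decidable R) (R-sym : Symmetric R) (R-trans : Transitive R) where

  private
    reflexive-at : ∀ {a xs} → Any (R a) xs → R a a
    reflexive-at (here r)  = R-trans r (R-sym r)
    reflexive-at (there p) = reflexive-at p

  labelling : ∀ xs → ∃[ k ] Labelling R (λ a → Any (R a) xs) k
  labelling []       = 0 , (λ _ ()) , (λ ()) , (λ _ ())
  labelling (x ∷ xs) with labelling xs | R? x x ×-dec ¬? (Any.any? (R? x) xs)
  ... | k , c , onto , exact | no old =
    k , (λ a p → c a (forget p)) , onto′ , (λ a p b q → exact a (forget p) b (forget q))
    where
    forget : ∀ {a} → Any (R a) (x ∷ xs) → Any (R a) xs
    forget (here r)  = Any.map (R-trans r)
      (decidable-stable (Any.any? (R? x) xs) λ x-new → old (R-trans (R-sym r) r , x-new))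
    forget (there p) = p
    onto′ : ∀ i → ∃[ a ] Σ (Any (R a) (x ∷ xs)) λ p → c a (forget p) ≡ i
    onto′ i with onto i
    ... | a , p , ca≡i = a , there p , ca≡i
  ... | k , c , onto , exact | yes (Rxx , x-new) = suc k , (λ a _ → class a) , onto′ , exact′
    where
    class : A → Fin (suc k)
    class a with Any.any? (R? a) xs
    ... | yes p = suc (c a p)
    ... | no _  = zero
    onto′ : ∀ i → ∃[ a ] Σ (Any (R a) (x ∷ xs)) λ _ → class a ≡ i
    onto′ zero = x , here Rxx , new-class
      where
      new-class : class x ≡ zero
      new-class with Any.any? (R? x) xs
      ... | yes p = contradiction p x-new
      ... | no _  = refl
    onto′ (suc i) with onto i
    ... | a , p , ca≡i = a , there p , old-class
      where
      old-class : class a ≡ suc i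
      old-class with Any.any? (R? a) xs
      ... | yes q = cong suc (trans (from (exact a q a p) (reflexive-at p)) ca≡i)
      ... | no ¬p = contradiction p ¬p
    exact′ : ∀ a (p : Any (R a) (x ∷ xs)) b (q : Any (R b) (x ∷ xs)) → (class a ≡ class b) ⇔ R a b
    exact′ a p b q with Any.any? (R? a) xs | Any.any? (R? b) xs
    ... | yes p′ | yes q′ = mk⇔ (to (exact a p′ b q′) ∘ suc-injective) (cong suc ∘ from (exact a p′ b q′))
    ... | yes p′ | no ¬q′ = mk⇔ (λ ()) (λ Rab → contradiction (Any.map (R-trans (R-sym Rab)) p′) ¬q′)
    ... | no ¬p′ | yes q′ = mk⇔ (λ ()) (λ Rab → contradiction (Any.map (R-trans Rab) q′) ¬p′)
    ... | no ¬p′ | no ¬q′ = mk⇔ (λ _ → both-at-x p q) (λ _ → refl)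
      where
      both-at-x : Any (R a) (x ∷ xs) → Any (R b) (x ∷ xs) → R a b
      both-at-x (here Rax)  (here Rbx)  = R-trans Rax (R-sym Rbx)
      both-at-x (there p″) _           = contradiction p″ ¬p′
      both-at-x _           (there q″) = contradiction q″ ¬q′

module _ {n : ℕ} {S : Subset n} where

  ∉∪⁅⁆ : ∀ {x y} → y ∉ S → y ≢ x → y ∉ S ∪ ⁅ x ⁆
  ∉∪⁅⁆ {x} y∉S y≢x y∈ with x∈p∪q⁻ S ⁅ x ⁆ y∈
  ... | inj₁ y∈S  = y∉S y∈S
  ... | inj₂ y∈⁅x⁆ = y≢x (x∈⁅y⁆⇒x≡y x y∈⁅x⁆)

  ∈∪⁅_⁆ : ∀ x → x ∈ S ∪ ⁅ x ⁆
  ∈∪⁅ x ⁆ = x∈p∪q⁺ (inj₂ (x∈⁅x⁆ x))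

  ⊆∪⁅_⁆ : ∀ x → S ⊆ S ∪ ⁅ x ⁆
  ⊆∪⁅ x ⁆ = x∈p∪q⁺ ∘ inj₁

  ∣∪⁅⁆∣-grows : ∀ {x} → x ∉ S → ∣ S ∣ < ∣ S ∪ ⁅ x ⁆ ∣
  ∣∪⁅⁆∣-grows {x} x∉S = p⊂q⇒∣p∣<∣q∣ (⊆∪⁅ x ⁆ , x , ∈∪⁅ x ⁆ , x∉S)

module _ {n : ℕ} (G : Graph n) where

  Adj? : Decidable (Adj G)
  Adj? u v = adj G u v ≟ᵇ true

  Adj-sym : Symmetric (Adj G)
  Adj-sym {u} {v} u~v = trans (Graph.sym G v u) u~v

  Adj-irrefl : ∀ {u v} → Adj G u v → v ≢ u
  Adj-irrefl {u} u~u refl with () ← trans (sym u~u) (irrefl G u)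

  Path-source : ∀ {S u v} → Path G S u v → u ∉ S
  Path-source (here u∉S)     = u∉S
  Path-source (step u∉S _ _) = u∉S

  Path-target : ∀ {S u v} → Path G S u v → v ∉ S
  Path-target (here v∉S)   = v∉S
  Path-target (step _ _ P) = Path-target P

  _++ₚ_ : ∀ {S u v w} → Path G S u v → Path G S v w → Path G S u w
  here _         ++ₚ Q = Q
  step u∉S u~w P ++ₚ Q = step u∉S u~w (P ++ₚ Q)

  Path-reverse : ∀ {S u v} → Path G S u v → Path G S v u
  Path-reverse (here u∉S)       = here u∉S
  Path-reverse (step u∉S u~w P) = Path-reverse P ++ₚ step (Path-source P) (Adj-sym u~w) (here u∉S)

  Path-antimono : ∀ {S T u v} → S ⊆ T → Path G T u v → Path G S u v
  Path-antimono S⊆T (here u∉T)       = here (u∉T ∘ S⊆T)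
  Path-antimono S⊆T (step u∉T u~w P) = step (u∉T ∘ S⊆T) u~w (Path-antimono S⊆T P)

  avoid-or-detour : ∀ {S x y v} → x ≢ v → Path G S y v →
                    Path G (S ∪ ⁅ x ⁆) y v ⊎ ∃[ w ] Adj G x w × Path G (S ∪ ⁅ x ⁆) w v
  avoid-or-detour x≢v (here v∉S) = inj₁ (here (∉∪⁅⁆ v∉S (x≢v ∘ sym)))
  avoid-or-detour {x = x} x≢v (step {y} {w} y∉S y~w P) with avoid-or-detour x≢v P
  ... | inj₂ detour = inj₂ detour
  ... | inj₁ P′ with y ≟ x
  ...   | yes refl = inj₂ (w , y~w , P′)
  ...   | no y≢x   = inj₁ (step (∉∪⁅⁆ y∉S y≢x) y~w P′)

  first-step : ∀ {S u v} → u ≢ v → Path G S u v → ∃[ w ] Adj G u w × Path G (S ∪ ⁅ u ⁆) w v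
  first-step {u = u} u≢v P with avoid-or-detour u≢v P
  ... | inj₁ P′     = contradiction ∈∪⁅ u ⁆ (Path-source P′)
  ... | inj₂ detour = detour

  -- The search from u continues in G - (S ∪ {u}), so n ∸ ∣ S ∣ bounds the depth of recursion.
  private
    path?-within : ∀ fuel S → n ≤ fuel + ∣ S ∣ → Decidable (Path G S)
    next-step? : ∀ fuel S {u} → n ≤ fuel + ∣ S ∣ → u ∉ S → ∀ v →
                 Dec (∃[ w ] Adj G u w × Path G (S ∪ ⁅ u ⁆) w v)

    path?-within fuel S bound u v with u ∈? S | u ≟ v
    ... | yes u∈S | _        = no λ P → Path-source P u∈S
    ... | no u∉S  | yes refl = yes (here u∉S)
    ... | no u∉S  | no u≢v   =
      Dec.map′ (λ (w , u~w , P) → step u∉S u~w (Path-antimono ⊆∪⁅ u ⁆ P)) (first-step u≢v)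
               (next-step? fuel S bound u∉S v)

    next-step? zero       S {u} bound u∉S v =
      contradiction (≤-trans (∣p∣≤n (S ∪ ⁅ u ⁆)) bound) (<⇒≱ (∣∪⁅⁆∣-grows u∉S))
    next-step? (suc fuel) S {u} bound u∉S v =
      any? λ w → Adj? u w ×-dec path?-within fuel (S ∪ ⁅ u ⁆) bound′ w v
      where
      bound′ : n ≤ fuel + ∣ S ∪ ⁅ u ⁆ ∣
      bound′ = ≤-trans bound (≤-trans (≤-reflexive (sym (+-suc fuel _))) (+-monoʳ-≤ fuel (∣∪⁅⁆∣-grows u∉S)))

  path? : ∀ S → Decidable (Path G S)
  path? S = path?-within n S (m≤m+n n ∣ S ∣)

  components : ∀ S → ∃[ k ] HasComponents G S k
  components S with labelling (path? S) Path-reverse _++ₚ_ (allFin n)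
  ... | k , c , onto , exact =
    k , (λ v v∉S → c v (near v∉S)) , onto′ , (λ u p v q → exact u (near p) v (near q))
    where
    near : ∀ {v} → v ∉ S → Any (Path G S v) (allFin n)
    near {v} v∉S = Any.map (λ { refl → here v∉S }) (∈-allFin v)
    onto′ : ∀ i → ∃[ v ] Σ (v ∉ S) λ v∉S → c v (near v∉S) ≡ i
    onto′ i with onto i
    ... | v , p , cv≡i = v , v∉S , trans (from (exact v (near v∉S) v p) (here v∉S)) cv≡i
      where v∉S = Path-source (proj₂ (Any.satisfied p))

  connected⇒oneComponent : Connected G → HasComponents G ∅ 1
  connected⇒oneComponent (0<n , path) =
    (λ _ _ → zero) , onto , (λ u _ v _ → mk⇔ (λ _ → path u v) (λ _ → refl))
    where
    onto : ∀ i → ∃[ v ] Σ (v ∉ ∅) λ _ → zero ≡ i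
    onto zero = fromℕ< 0<n , ∉⊥ , refl

  separated⇒cutVertex : Connected G → ∀ {x u w} → u ≢ x → w ≢ x → ¬ Path G ⁅ x ⁆ u w → CutVertex G x
  separated⇒cutVertex conn {x} {u} {w} u≢x w≢x u↛w with components ⁅ x ⁆
  ... | k , H@(c , _ , exact) =
    1 , k , connected⇒oneComponent conn , H ,
    distinct⇒1< (u↛w ∘ to (exact u (x≢y⇒x∉⁅y⁆ u≢x) w (x≢y⇒x∉⁅y⁆ w≢x)))

  boundary-crossing : ∀ {S T a b} → Path G T a b → a ∉ S → ¬ Path G S a b →
                      ∃₂ λ v s → v ∉ T × Path G S a v × s ∈ S × Adj G v s
  boundary-crossing (here _) a∉S a↛b = contradiction (here a∉S) a↛b
  boundary-crossing {S} {a = a} (step a∉T a~w P) a∉S a↛b with _ ∈? S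
  ... | yes w∈S = a , _ , a∉T , here a∉S , w∈S , a~w
  ... | no  w∉S with boundary-crossing P w∉S (a↛b ∘ step a∉S a~w)
  ...   | v , s , v∉T , w⇝v , s∈S , v~s = v , s , v∉T , step a∉S a~w w⇝v , s∈S , v~s

  module _ (S : Subset n) where

    neighboursIn : Fin n → ℕ
    neighboursIn v = ∑[ s < n ] (𝟙 (adj G v s) * 𝟙 (lookup S s))

    degree≡column-sum : ∀ v → degree G v ≡ ∑[ s < n ] 𝟙 (adj G s v)
    degree≡column-sum v = trans (∣tabulate∣≡sum (adj G v)) (sum-cong-≗ λ s → cong 𝟙 (Graph.sym G v s))

    sum-neighboursIn : ∀ {r} → Regular G r → ∑[ v < n ] neighboursIn v ≡ r * ∣ S ∣
    sum-neighboursIn {r} regular = begin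
      ∑[ v < n ] ∑[ s < n ] (e v s * χ s)    ≡⟨ ∑-comm (λ v s → e v s * χ s) ⟩
      ∑[ s < n ] ∑[ v < n ] (e v s * χ s)    ≡⟨ sum-cong-≗ (λ s → sym (*-distribʳ-sum (χ s) λ v → e v s)) ⟩
      ∑[ s < n ] ((∑[ v < n ] e v s) * χ s)  ≡⟨ sum-cong-≗ (λ s → cong (_* χ s) (column s)) ⟩
      ∑[ s < n ] (r * χ s)                   ≡⟨ sym (*-distribˡ-sum r χ) ⟩
      r * sum χ                              ≡⟨ cong (r *_) (sym (∣p∣≡sum S)) ⟩
      r * ∣ S ∣                              ∎
      where
      open ≡-Reasoning
      e : Fin n → Fin n → ℕ
      e v s = 𝟙 (adj G v s)
      χ : Fin n → ℕ
      χ = 𝟙 ∘ lookup S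
      column : ∀ s → ∑[ v < n ] e v s ≡ r
      column s = trans (sym (degree≡column-sum s)) (regular s)

    neighboursIn-pos : ∀ {v s} → Adj G v s → s ∈ S → 1 ≤ neighboursIn v
    neighboursIn-pos {v} {s} v~s s∈S = subst (_≤ neighboursIn v) edge (term≤sum _ s)
      where
      edge : 𝟙 (adj G v s) * 𝟙 (lookup S s) ≡ 1
      edge rewrite v~s | []=⇒lookup s∈S = refl

    neighboursIn≡degree : ∀ {v} → (∀ {z} → Adj G v z → z ∈ S) → neighboursIn v ≡ degree G v
    neighboursIn≡degree {v} inS = trans (sum-cong-≗ term) (sym (∣tabulate∣≡sum (adj G v)))
      where
      term : ∀ z → 𝟙 (adj G v z) * 𝟙 (lookup S z) ≡ 𝟙 (adj G v z)
      term z with adj G v z in v~z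
      ... | false = refl
      ... | true rewrite []=⇒lookup (inS v~z) = refl

    outside-neighbour : ∀ {v} → 2 ≤ degree G v → neighboursIn v ≤ 1 → ∃[ z ] Adj G v z × z ∉ S
    outside-neighbour {v} 2≤deg few with any? (λ z → Adj? v z ×-dec ¬? (z ∈? S))
    ... | yes found = found
    ... | no none   = contradiction (subst (2 ≤_) (sym (neighboursIn≡degree inS)) 2≤deg) (≤⇒≯ few)
      where
      inS : ∀ {z} → Adj G v z → z ∈ S
      inS {z} v~z = decidable-stable (z ∈? S) λ z∉S → none (z , v~z , z∉S)

    component-weight : Fin n → ℕ
    component-weight r = ∑[ v < n ] (if does (path? S r v) then neighboursIn v else 0)

    private
      reached-term : ∀ {r v} → Path G S r v →
                     (if does (path? S r v) then neighboursIn v else 0) ≡ neighboursIn v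
      reached-term {r} {v} r⇝v = cong (λ b → if b then neighboursIn v else 0) (dec-true (path? S r v) r⇝v)

    reached≤component-weight : ∀ {r v} → Path G S r v → neighboursIn v ≤ component-weight r
    reached≤component-weight {r} {v} r⇝v = subst (_≤ component-weight r) (reached-term r⇝v) (term≤sum _ v)

    two-reached≤component-weight : ∀ {r x v} → x ≢ v → Path G S r x → Path G S r v →
                                   neighboursIn x + neighboursIn v ≤ component-weight r
    two-reached≤component-weight {r} x≢v r⇝x r⇝v =
      subst (_≤ component-weight r) (cong₂ _+_ (reached-term r⇝x) (reached-term r⇝v)) (two-terms≤sum _ x≢v)

  NoSeparatingVertex : Set
  NoSeparatingVertex = ∀ x u w → u ≢ x → w ≢ x → Path G ⁅ x ⁆ u w

  boundary-weight : Connected G → NoSeparatingVertex → (∀ v → 2 ≤ degree G v) →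
                    ∀ {S r y} → r ∉ S → ¬ Path G S r y → 2 ≤ component-weight S r
  boundary-weight (_ , path) no-sep 2≤deg {S} {r} {y} r∉S r↛y
    with boundary-crossing (path r y) r∉S r↛y
  ... | x , s , _ , r⇝x , s∈S , x~s with neighboursIn S x ≤? 1
  ...   | no  many = ≤-trans (≰⇒> many) (reached≤component-weight S r⇝x)
  ...   | yes few with outside-neighbour S (2≤deg x) few
  ...     | z , x~z , z∉S
    with boundary-crossing (no-sep x z s (Adj-irrefl x~z) λ { refl → Path-target r⇝x s∈S }) z∉S
                           (λ z⇝s → Path-target z⇝s s∈S)
  ...       | v , s′ , v∉⁅x⁆ , z⇝v , s′∈S , v~s′ =
    ≤-trans (+-mono-≤ (neighboursIn-pos S x~s s∈S) (neighboursIn-pos S v~s′ s′∈S))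
            (two-reached≤component-weight S (x∉⁅y⁆⇒x≢y v∉⁅x⁆ ∘ sym) r⇝x
                                            (r⇝x ++ₚ step (Path-target r⇝x) x~z z⇝v))

  module _ {S : Subset n} {k : ℕ} (H : HasComponents G S k) (default : Fin k) where

    private
      c = proj₁ H
      exact = proj₂ (proj₂ H)

    -- Vertices of S land in the class default, which only increases its weight.
    class : Fin n → Fin k
    class v with v ∈? S
    ... | yes _   = default
    ... | no  v∉S = c v v∉S

    class-∉ : ∀ {v} (v∉S : v ∉ S) → class v ≡ c v v∉S
    class-∉ {v} v∉S with v ∈? S
    ... | yes v∈S = contradiction v∈S v∉S
    ... | no  v∉S′ = from (exact v v∉S′ v v∉S) (here v∉S′)

    class-weight : Fin k → ℕ
    class-weight i = ∑[ v < n ] (if does (class v ≟ i) then neighboursIn S v else 0)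

    component-weight≤class-weight : ∀ {r i} (r∉S : r ∉ S) → c r r∉S ≡ i →
                                    component-weight S r ≤ class-weight i
    component-weight≤class-weight {r} {i} r∉S cr≡i = sum-mono-≤ term
      where
      term : ∀ v → (if does (path? S r v) then neighboursIn S v else 0)
                 ≤ (if does (class v ≟ i) then neighboursIn S v else 0)
      term v with path? S r v
      ... | no  _   = z≤n
      ... | yes r⇝v =
        ≤-reflexive (cong (λ b → if b then neighboursIn S v else 0) (sym (dec-true (class v ≟ i) class≡i)))
        where
        v∉S = Path-target r⇝v
        class≡i : class v ≡ i
        class≡i = trans (class-∉ v∉S) (trans (sym (from (exact r r∉S v v∉S) r⇝v)) cr≡i)

  toughness-bound : ∀ {r S k} → Connected G → NoSeparatingVertex → Regular G r → 2 ≤ r →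
                    HasComponents G S k → 1 < k → 2 * k ≤ r * ∣ S ∣
  toughness-bound {r} {S} {k} conn no-sep regular 2≤r H@(c , onto , exact) 1<k = begin
    2 * k                                   ≡⟨ *-comm 2 k ⟩
    k * 2                                   ≡⟨ sum-const k 2 ⟨
    ∑[ i < k ] 2                            ≤⟨ sum-mono-≤ 2≤class-weight ⟩
    ∑[ i < k ] class-weight H default i     ≡⟨ sum-fibres (class H default) (neighboursIn S) ⟩
    ∑[ v < n ] neighboursIn S v             ≡⟨ sum-neighboursIn S regular ⟩
    r * ∣ S ∣                               ∎
    where
    open ≤-Reasoning
    default : Fin k
    default = fromℕ< (<-trans (s≤s z≤n) 1<k)
    2≤deg : ∀ v → 2 ≤ degree G v
    2≤deg v = subst (2 ≤_) (sym (regular v)) 2≤r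
    2≤class-weight : ∀ i → 2 ≤ class-weight H default i
    2≤class-weight i with onto i | other-index 1<k i
    ... | x , x∉S , cx≡i | j , j≢i with onto j
    ...   | y , y∉S , cy≡j =
      ≤-trans (boundary-weight conn no-sep 2≤deg x∉S x↛y) (component-weight≤class-weight H default x∉S cx≡i)
      where
      x↛y : ¬ Path G S x y
      x↛y x⇝y = j≢i (trans (sym cy≡j) (trans (sym (from (exact x x∉S y y∉S) x⇝y)) cx≡i))

  separated-or-noSeparatingVertex :
    (∃[ x ] ∃[ u ] ∃[ w ] u ≢ x × w ≢ x × ¬ Path G ⁅ x ⁆ u w) ⊎ NoSeparatingVertex
  separated-or-noSeparatingVertex with any? (λ x → any? λ u → any? λ w →
                                          ¬? (u ≟ x) ×-dec ¬? (w ≟ x) ×-dec ¬? (path? ⁅ x ⁆ u w))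
  ... | yes separated = inj₁ separated
  ... | no  none      = inj₂ λ x u w u≢x w≢x →
    decidable-stable (path? ⁅ x ⁆ u w) λ u↛w → none (x , u , w , u≢x , w≢x , u↛w)

  cutVertex⇒2≤components : ∀ {x} → 0 < n → CutVertex G x → ∃[ k ] HasComponents G ⁅ x ⁆ k × 2 ≤ k
  cutVertex⇒2≤components 0<n (k , k′ , (c , _) , H , k<k′) =
    k′ , H , ≤-trans (s≤s (>-nonZero⁻¹ k ⦃ nonZeroIndex (c (fromℕ< 0<n) ∉⊥) ⦄)) k<k′

½ ⅔ : ℚ
½ = + 1 / 2
⅔ = + 2 / 3

private
  n/1≡mkℚ : ∀ m → + m / 1 ≡ mkℚ (+ m) 0 (Coprime-sym (1-coprimeTo m))
  n/1≡mkℚ m = normalize-coprime _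

  toℚᵘ-*-n/1 : ∀ t m → toℚᵘ (t ℚ.* (+ m / 1)) ℚᵘ.≃ toℚᵘ t ℚᵘ.* ℚᵘ.mkℚᵘ (+ m) 0
  toℚᵘ-*-n/1 t m = subst (λ q → toℚᵘ (t ℚ.* (+ m / 1)) ℚᵘ.≃ toℚᵘ t ℚᵘ.* q)
                         (cong toℚᵘ (n/1≡mkℚ m)) (toℚᵘ-homo-* t (+ m / 1))

⅔-*-≤ : ∀ k s → 2 * k ≤ 3 * s → ⅔ ℚ.* (+ k / 1) ℚ.≤ + s / 1
⅔-*-≤ k s 2k≤3s = toℚᵘ-cancel-≤ (ℚᵘ.≤-respˡ-≃ (ℚᵘ.≃-sym (toℚᵘ-*-n/1 ⅔ k)) ⅔k≤s)
  where
  ⅔k≤s : ℚᵘ.mkℚᵘ (+ 2 ℤ.* + k) 2 ℚᵘ.≤ toℚᵘ (+ s / 1)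
  ⅔k≤s rewrite n/1≡mkℚ s = ℚᵘ.*≤* (subst₂ ℤ._≤_ 2k≡ 3s≡ (ℤ.+≤+ 2k≤3s))
    where
    2k≡ : + (2 * k) ≡ (+ 2 ℤ.* + k) ℤ.* + 1
    2k≡ = trans (ℤ.pos-* 2 k) (sym (ℤ.*-identityʳ _))
    3s≡ : + (3 * s) ≡ + s ℤ.* + 3
    3s≡ = trans (ℤ.pos-* 3 s) (ℤ.*-comm (+ 3) (+ s))

≤½-from-*≤1 : ∀ t k → 2 ≤ k → t ℚ.* (+ k / 1) ℚ.≤ + 1 / 1 → t ℚ.≤ ½
≤½-from-*≤1 (mkℚ -[1+ _ ] _ _) _ _ _ = ℚ.*≤* ℤ.-≤+
≤½-from-*≤1 t@(mkℚ (+ a) d _) k 2≤k tk≤1 =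
  ℚ.*≤* (subst₂ ℤ._≤_ (ℤ.pos-* a 2) (sym (ℤ.*-identityˡ _)) (ℤ.+≤+ (≤-trans (*-monoʳ-≤ a 2≤k) ak≤d+1)))
  where
  tk≤1ᵘ : (+ a ℤ.* + k) ℤ.* + 1 ℤ.≤ + 1 ℤ.* + suc (d * 1)
  tk≤1ᵘ = ℚᵘ.drop-*≤* (ℚᵘ.≤-respˡ-≃ (toℚᵘ-*-n/1 t k) (toℚᵘ-mono-≤ tk≤1))
  ak≤d+1 : a * k ≤ suc d
  ak≤d+1 = ℤ.drop‿+≤+ (subst₂ ℤ._≤_ (trans (ℤ.*-identityʳ _) (sym (ℤ.pos-* a k)))
                                     (trans (ℤ.*-identityˡ _) (cong (λ m → + suc m) (*-identityʳ d))) tk≤1ᵘ)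

lemma5p4 : ∀ {n : ℕ} (G : Graph n) → Connected G → Regular G 3 →
           (HasCutVertex G ⇔ τ≤ G ((+ 1) / 2)) × (τ≤ G ((+ 1) / 2) ⇔ τ< G ((+ 2) / 3))
lemma5p4 G conn cubic = mk⇔ cut⇒τ≤½ (τ<⅔⇒cut ∘ τ≤½⇒τ<⅔) , mk⇔ τ≤½⇒τ<⅔ (cut⇒τ≤½ ∘ τ<⅔⇒cut)
  where
  cut⇒τ≤½ : HasCutVertex G → τ≤ G ½
  cut⇒τ≤½ (x , cut) t tough with cutVertex⇒2≤components G (proj₁ conn) cut
  ... | k , H , 2≤k =
    ≤½-from-*≤1 t k 2≤k (subst (λ m → t ℚ.* (+ k / 1) ℚ.≤ + m / 1) (∣⁅x⁆∣≡1 x) (tough ⁅ x ⁆ k H 2≤k))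

  τ≤½⇒τ<⅔ : τ≤ G ½ → τ< G ⅔
  τ≤½⇒τ<⅔ τ≤½ = ½ , toWitness {a? = ½ ℚ.<? ⅔} _ , τ≤½

  τ<⅔⇒cut : τ< G ⅔ → HasCutVertex G
  τ<⅔⇒cut (r , r<⅔ , τ≤r) with separated-or-noSeparatingVertex G
  ... | inj₁ (x , u , w , u≢x , w≢x , u↛w) = x , separated⇒cutVertex G conn u≢x w≢x u↛w
  ... | inj₂ no-sep = contradiction (ℚ.<-≤-trans r<⅔ (τ≤r ⅔ ⅔-tough)) (ℚ.<-irrefl refl)
    where
    ⅔-tough : Tough G ⅔
    ⅔-tough S k H 1<k = ⅔-*-≤ k ∣ S ∣ (toughness-bound G conn no-sep cubic (s≤s (s≤s z≤n)) H 1<k)
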